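{- Let $T$ be a tree and let $T_1,T_2$ be subtrees of $T$ such that $\mathcal{C}(T_1)\subseteq\mathcal{C}(T_2)$. Then $\mathrm{diam}(T_1\cup T_2)=\max\{\mathrm{diam}(T_1),\mathrm{diam}(T_2)\}$.
   Context: For a tree $T'$, $\mathcal{C}(T')$ is its center, i.e. the set of nodes of minimum eccentricity in $T'$. Subtrees are connected subgraphs of $T$, and $T_1\cup T_2$ is the subgraph induced by the union of their node sets. -}

module Defs where

open import Data.Nat using (ℕ; zero; suc; _≤_; _+_)
open import Data.Fin using (Fin; zero; suc; fromℕ; inject₁)
open import Data.Fin.Subset using (Subset; _∈_; _∪_; Nonempty)
open import Data.Bool using (Bool; true; false)
open import Data.Product using (Σ; ∃; ∃-syntax; _×_; _,_)
open import Relation.Binary.PropositionalEquality using (_≡_)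
open import Relation.Nullary using (¬_)
open import Function.Definitions using (Injective)

record Graph (n : ℕ) : Set where
  field
    adj   : Fin n → Fin n → Bool
    sym   : ∀ u v → adj u v ≡ adj v u
    irref : ∀ u → adj u u ≡ false
open Graph public

module _ {n : ℕ} (G : Graph n) where

  -- Walks of length k from u to v all of whose vertices lie in S
  -- (i.e. walks in the subgraph of G induced by S).
  data Walk (S : Subset n) : Fin n → Fin n → ℕ → Set where
    nil  : ∀ {u} → u ∈ S → Walk S u u 0
    cons : ∀ {u w v k} → u ∈ S → adj G u w ≡ true →
           Walk S w v k → Walk S u v (suc k)

  Connected : Subset n → Set
  Connected S = ∀ u v → u ∈ S → v ∈ S → ∃[ k ] Walk S u v k

  HasCycle : Set
  HasCycle = ∃[ k ] Σ (Fin (suc (suc (suc k))) → Fin n) λ c →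
      Injective _≡_ _≡_ c
    × (∀ (i : Fin (suc (suc k))) → adj G (c (inject₁ i)) (c (suc i)) ≡ true)
    × adj G (c (fromℕ (suc (suc k)))) (c zero) ≡ true

  full : Subset n
  full = Data.Fin.Subset.⊤

  IsTree : Set
  IsTree = Nonempty full × Connected full × ¬ HasCycle

  IsSubtree : Subset n → Set
  IsSubtree S = Nonempty S × Connected S

  Dist : Subset n → Fin n → Fin n → ℕ → Set
  Dist S u v d = Walk S u v d × (∀ k → Walk S u v k → d ≤ k)

  Ecc : Subset n → Fin n → ℕ → Set
  Ecc S u e = (∀ v d → v ∈ S → Dist S u v d → d ≤ e)
            × (∃[ v ] (v ∈ S × Dist S u v e))

  InCenter : Subset n → Fin n → Set
  InCenter S u = u ∈ S × ∃[ e ] (Ecc S u e ×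
                   (∀ w e' → w ∈ S → Ecc S w e' → e ≤ e'))

  -- d is the diameter of the subgraph induced by S (which must be
  -- connected for the diameter to be finite).
  Diam : Subset n → ℕ → Set
  Diam S d = Connected S
           × (∀ u v d' → u ∈ S → v ∈ S → Dist S u v d' → d' ≤ d)
           × (∃[ u ] ∃[ v ] (u ∈ S × v ∈ S × Dist S u v d))

module Submission where

-- From these follow the radius bound
-- 2·ecc(c) ≤ diam + 1 for a central c, and the "centre shift": when this bound
-- is tight, stepping from c towards a farthest vertex stays central.  The
-- theorem is then a short assembly: a central c of T₁ is central in T₂, so the
-- union is connected, and any u ∈ T₁, v ∈ T₂ satisfy dist u v ≤ max(d₁, d₂),
-- since otherwise the centre shift yields a central vertex too close to both.

open import Defs
open import Data.Nat using (ℕ; zero; suc; _+_; _≤_; _<_; z≤n; s≤s; _⊔_)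
open import Data.Nat.Properties hiding (_≟_)
open import Algebra.Properties.CommutativeSemigroup +-commutativeSemigroup using (interchange)
open import Data.Fin using (Fin; zero; suc; fromℕ; inject₁; _≟_)
open import Data.Fin.Subset using (Subset; _∈_; _∪_; _⊆_)
open import Data.Fin.Subset.Properties using (_∈?_; ∈⊤; p⊆p∪q; q⊆p∪q; x∈p∪q⁻)
open import Data.Product using (∃; ∃-syntax; _×_; _,_; proj₁; proj₂)
open import Data.List using (List; filter; allFin)
open import Data.List.Membership.Propositional using () renaming (_∈_ to _∈ᴸ_)
open import Data.List.Membership.Propositional.Properties using (∈-filter⁺; ∈-allFin)
import Data.List.Relation.Unary.All as All
open import Data.List.Relation.Unary.All.Properties using (all-filter)
open import Data.List.Extrema.Nat using (argmax; argmin; argmax-all; argmin-all; f[xs]≤f[argmax]; f[argmin]≤f[xs])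
open import Data.Sum using (_⊎_; inj₁; inj₂; [_,_]′; map₁)
open import Data.Bool using (true)
open import Data.Empty using (⊥; ⊥-elim)
open import Function using (_∘_; id)
open import Relation.Nullary using (¬_; Dec; yes; no)
open import Relation.Nullary.Decidable using (map′; _⊎-dec_)
open import Relation.Binary.PropositionalEquality as ≡
  using (_≡_; _≢_; refl; cong; subst; trans)

open ≤-Reasoning

double-cancel : ∀ {x y} → x + x ≤ y + y → x ≤ y
double-cancel {x} {y} 2x≤2y with x ≤? y
... | yes x≤y = x≤y
... | no  x≰y = ⊥-elim (<⇒≱ (+-mono-< (≰⇒> x≰y) (≰⇒> x≰y)) 2x≤2y)

radii-tight : ∀ {D a b e₁ e₂ d₁ d₂} → d₁ ⊔ d₂ < D → D ≤ a + b → a ≤ e₁ → b ≤ e₂ →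
              e₁ + e₁ ≤ suc d₁ → e₂ + e₂ ≤ suc d₂ →
              a ≡ e₁ × e₁ + e₂ ≤ D × d₁ < e₁ + e₁
radii-tight {D} {a} {b} {e₁} {e₂} {d₁} {d₂} M<D D≤a+b a≤e₁ b≤e₂ 2e₁≤ 2e₂≤ =
  ≤-antisym a≤e₁ e₁≤a , radii≤D , d₁<2e₁
  where
    M = d₁ ⊔ d₂
    2e₁≤M+1 : e₁ + e₁ ≤ suc M
    2e₁≤M+1 = ≤-trans 2e₁≤ (s≤s (m≤m⊔n d₁ d₂))
    2e₂≤M+1 : e₂ + e₂ ≤ suc M
    2e₂≤M+1 = ≤-trans 2e₂≤ (s≤s (m≤n⊔m d₁ d₂))
    radii≤D : e₁ + e₂ ≤ D
    radii≤D = ≤-trans (double-cancel (begin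
      (e₁ + e₂) + (e₁ + e₂) ≡⟨ interchange e₁ e₂ e₁ e₂ ⟩
      (e₁ + e₁) + (e₂ + e₂) ≤⟨ +-mono-≤ 2e₁≤M+1 2e₂≤M+1 ⟩
      suc M + suc M         ∎)) M<D
    e₁≤a : e₁ ≤ a
    e₁≤a = +-cancelʳ-≤ b e₁ a (≤-trans (+-monoʳ-≤ e₁ b≤e₂) (≤-trans radii≤D D≤a+b))
    d₁<2e₁ : d₁ < e₁ + e₁
    d₁<2e₁ = ≤-trans (s≤s (m≤m⊔n d₁ d₂)) (+-cancelʳ-≤ (e₂ + e₂) (suc M) (e₁ + e₁) (begin
      suc M + (e₂ + e₂)     ≤⟨ +-monoʳ-≤ (suc M) 2e₂≤M+1 ⟩
      suc M + suc M         ≤⟨ +-mono-≤ (≤-trans M<D radii≤D′) (≤-trans M<D radii≤D′) ⟩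
      (e₁ + e₂) + (e₁ + e₂) ≡⟨ interchange e₁ e₂ e₁ e₂ ⟩
      (e₁ + e₁) + (e₂ + e₂) ∎))
      where
        radii≤D′ : D ≤ e₁ + e₂
        radii≤D′ = ≤-trans D≤a+b (+-mono-≤ a≤e₁ b≤e₂)

-- Walks and paths in an arbitrary finite graph G.
module Walks {n : ℕ} (G : Graph n) where

  V : Set
  V = Fin n

  private variable
    u v w x y z : V
    i j k : ℕ
    S : Subset n

  infix 4 _~_
  _~_ : V → V → Set
  u ~ v = adj G u v ≡ true

  ~-sym : u ~ v → v ~ u
  ~-sym {u} {v} e = trans (Graph.sym G v u) e

  ~-irrefl : u ~ v → u ≢ v
  ~-irrefl {u} e refl with trans (≡.sym (irref G u)) e
  ... | ()

  infixr 5 _∷_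
  data GWalk : V → V → ℕ → Set where
    []  : GWalk u u 0
    _∷_ : u ~ w → GWalk w v k → GWalk u v (suc k)

  infix 4 _∈ʷ_ _∉ʷ_
  data _∈ʷ_ (z : V) : GWalk u v k → Set where
    first : {p : GWalk u v k} → z ≡ u → z ∈ʷ p
    later : {e : u ~ w} {p : GWalk w v k} → z ∈ʷ p → z ∈ʷ e ∷ p

  _∉ʷ_ : V → GWalk u v k → Set
  z ∉ʷ p = ¬ z ∈ʷ p

  ∈ʷ-[] : z ∈ʷ [] {u} → z ≡ u
  ∈ʷ-[] (first z≡u) = z≡u

  ∈ʷ-∷ : {e : u ~ w} {p : GWalk w v k} → z ∈ʷ e ∷ p → z ≡ u ⊎ z ∈ʷ p
  ∈ʷ-∷ (first z≡u) = inj₁ z≡u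
  ∈ʷ-∷ (later z∈p) = inj₂ z∈p

  end∈ʷ : (p : GWalk u v k) → v ∈ʷ p
  end∈ʷ []      = first refl
  end∈ʷ (e ∷ p) = later (end∈ʷ p)

  _∈ʷ?_ : (x : V) (p : GWalk u v k) → Dec (x ∈ʷ p)
  x ∈ʷ? []                = map′ first ∈ʷ-[] (x ≟ _)
  _∈ʷ?_ {u} x (e ∷ p) = map′ [ first , later ]′ ∈ʷ-∷ ((x ≟ u) ⊎-dec (x ∈ʷ? p))

  data IsPath : GWalk u v k → Set where
    []  : IsPath ([] {u})
    _∷_ : {e : u ~ w} {p : GWalk w v k} → u ∉ʷ p → IsPath p → IsPath (e ∷ p)

  infixr 5 _++_
  _++_ : GWalk u x i → GWalk x v j → GWalk u v (i + j)
  []      ++ q = q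
  (e ∷ p) ++ q = e ∷ (p ++ q)

  ∈ʷ-++ : (p : GWalk u x i) (q : GWalk x v j) → z ∈ʷ p ++ q → z ∈ʷ p ⊎ z ∈ʷ q
  ∈ʷ-++ []      q z∈q         = inj₂ z∈q
  ∈ʷ-++ (e ∷ p) q (first z≡u) = inj₁ (first z≡u)
  ∈ʷ-++ (e ∷ p) q (later z∈)  = map₁ later (∈ʷ-++ p q z∈)

  ++-path : {p : GWalk u x i} {q : GWalk x v j} → IsPath p → IsPath q →
            (∀ {z} → z ∈ʷ p → z ∈ʷ q → z ≡ x) → IsPath (p ++ q)
  ++-path {p = []}    _               q-path meet = q-path
  ++-path {p = e ∷ p} {q = q} (u∉p ∷ p-path) q-path meet =
    [ u∉p , u∉p ∘ junction ]′ ∘ ∈ʷ-++ p q ∷ ++-path p-path q-path (meet ∘ later)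
    where
      junction : _ ∈ʷ q → _ ∈ʷ p
      junction u∈q = subst (_∈ʷ p) (≡.sym (meet (first refl) u∈q)) (end∈ʷ p)

  snoc : GWalk u v k → v ~ w → GWalk u w (suc k)
  snoc []      e = e ∷ []
  snoc (e′ ∷ p) e = e′ ∷ snoc p e

  reverse : GWalk u v k → GWalk v u k
  reverse []      = []
  reverse (e ∷ p) = snoc (reverse p) (~-sym e)

  record Split (p : GWalk u v k) (x : V) : Set where
    field
      {i₁ i₂}     : ℕ
      prefix      : GWalk u x i₁
      suffix      : GWalk x v i₂
      lengths     : i₁ + i₂ ≡ k
      prefix-path : IsPath prefix
      suffix-path : IsPath suffix
      prefix⊆     : ∀ {z} → z ∈ʷ prefix → z ∈ʷ p
      suffix⊆     : ∀ {z} → z ∈ʷ suffix → z ∈ʷ p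

  split : {p : GWalk u v k} → IsPath p → x ∈ʷ p → Split p x
  split {p = p} p-path (first refl) = record
    { prefix = [] ; suffix = p ; lengths = refl
    ; prefix-path = [] ; suffix-path = p-path
    ; prefix⊆ = first ∘ ∈ʷ-[] ; suffix⊆ = id }
  split {p = e ∷ p} (u∉p ∷ p-path) (later x∈p) = record
    { prefix = e ∷ S.prefix ; suffix = S.suffix ; lengths = cong suc S.lengths
    ; prefix-path = u∉p ∘ S.prefix⊆ ∷ S.prefix-path ; suffix-path = S.suffix-path
    ; prefix⊆ = [ first , later ∘ S.prefix⊆ ]′ ∘ ∈ʷ-∷ ; suffix⊆ = later ∘ S.suffix⊆ }
    where module S = Split (split p-path x∈p)

  record Shortcut (p : GWalk u v k) : Set where
    field
      {len}   : ℕ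
      walk    : GWalk u v len
      is-path : IsPath walk
      shorter : len ≤ k
      walk⊆   : ∀ {z} → z ∈ʷ walk → z ∈ʷ p

  prepend : ∀ {p : GWalk w v k} (e : u ~ w) → Shortcut p → Shortcut (e ∷ p)
  prepend {u = u} e s with u ∈ʷ? Shortcut.walk s
  ... | yes u∈q = record
    { walk = C.suffix ; is-path = C.suffix-path
    ; shorter = ≤-trans (m≤n+m C.i₂ C.i₁) (≤-trans (≤-reflexive C.lengths) (m≤n⇒m≤1+n shorter))
    ; walk⊆ = later ∘ walk⊆ ∘ C.suffix⊆ }
    where open Shortcut s
          module C = Split (split is-path u∈q)
  ... | no u∉q = record
    { walk = e ∷ walk ; is-path = u∉q ∷ is-path ; shorter = s≤s shorter
    ; walk⊆ = [ first , later ∘ walk⊆ ]′ ∘ ∈ʷ-∷ }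
    where open Shortcut s

  shortcut : (p : GWalk u v k) → Shortcut p
  shortcut []      = record { walk = [] ; is-path = [] ; shorter = z≤n ; walk⊆ = id }
  shortcut (e ∷ p) = prepend e (shortcut p)

  vertex : GWalk u v k → Fin (suc k) → V
  vertex {u} p       zero    = u
  vertex     (e ∷ p) (suc i) = vertex p i

  vertex-last : (p : GWalk u v k) → vertex p (fromℕ k) ≡ v
  vertex-last []      = refl
  vertex-last (e ∷ p) = vertex-last p

  vertex-step : (p : GWalk u v k) (i : Fin k) → vertex p (inject₁ i) ~ vertex p (suc i)
  vertex-step (e ∷ p) zero    = e
  vertex-step (e ∷ p) (suc i) = vertex-step p i

  vertex∈ʷ : (p : GWalk u v k) (i : Fin (suc k)) → vertex p i ∈ʷ p
  vertex∈ʷ p       zero    = first refl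
  vertex∈ʷ (e ∷ p) (suc i) = later (vertex∈ʷ p i)

  vertex-injective : {p : GWalk u v k} → IsPath p → ∀ i j → vertex p i ≡ vertex p j → i ≡ j
  vertex-injective _                        zero    zero    _  = refl
  vertex-injective {p = e ∷ p} (u∉p ∷ _)    zero    (suc j) eq = ⊥-elim (u∉p (subst (_∈ʷ p) (≡.sym eq) (vertex∈ʷ p j)))
  vertex-injective {p = e ∷ p} (u∉p ∷ _)    (suc i) zero    eq = ⊥-elim (u∉p (subst (_∈ʷ p) eq (vertex∈ʷ p i)))
  vertex-injective {p = e ∷ p} (_ ∷ p-path) (suc i) (suc j) eq = cong suc (vertex-injective p-path i j eq)

  chord-cycle : (p : GWalk u x k) → IsPath p → 2 ≤ k → x ~ u → HasCycle G
  chord-cycle {u = u} {k = suc (suc k)} p p-path _ e =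
    k , vertex p , (λ {i} {j} → vertex-injective p-path i j) , vertex-step p ,
    subst (λ t → t ~ u) (≡.sym (vertex-last p)) e
  chord-cycle {k = 1} _ _ (s≤s ()) _

  walk-nonempty : GWalk u x k → u ≢ x → 1 ≤ k
  walk-nonempty []      u≢x = ⊥-elim (u≢x refl)
  walk-nonempty (e ∷ p) _   = s≤s z≤n

  forget : Walk G S u v k → GWalk u v k
  forget (nil _)      = []
  forget (cons _ e w) = e ∷ forget w

  forget⊆ : (w : Walk G S u v k) → z ∈ʷ forget w → z ∈ S
  forget⊆ (nil u∈S)      z∈ = subst (_∈ _) (≡.sym (∈ʷ-[] z∈)) u∈S
  forget⊆ (cons u∈S e w) (first refl) = u∈S
  forget⊆ (cons u∈S e w) (later z∈)   = forget⊆ w z∈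

  lift : (p : GWalk u v k) → (∀ {z} → z ∈ʷ p → z ∈ S) → Walk G S u v k
  lift []      inside = nil (inside (first refl))
  lift (e ∷ p) inside = cons (inside (first refl)) e (lift p (inside ∘ later))

  record PathIn (S : Subset n) (u v : V) : Set where
    field
      {len}   : ℕ
      walk    : GWalk u v len
      is-path : IsPath walk
      inside  : ∀ {z} → z ∈ʷ walk → z ∈ S

  path-in : Connected G S → u ∈ S → v ∈ S → PathIn S u v
  path-in conn u∈S v∈S = record
    { walk = walk ; is-path = is-path ; inside = forget⊆ route ∘ walk⊆ }
    where
      route = proj₂ (conn _ _ u∈S v∈S)
      open Shortcut (shortcut (forget route))

  walk-mono : {S′ : Subset n} → S ⊆ S′ → Walk G S u v k → Walk G S′ u v k
  walk-mono S⊆S′ (nil u∈S)      = nil (S⊆S′ u∈S)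
  walk-mono S⊆S′ (cons u∈S e w) = cons (S⊆S′ u∈S) e (walk-mono S⊆S′ w)

  walk-append : Walk G S u x i → Walk G S x v j → Walk G S u v (i + j)
  walk-append (nil _)        w′ = w′
  walk-append (cons u∈S e w) w′ = cons u∈S e (walk-append w w′)

  ∪-connected : {S₁ S₂ : Subset n} → Connected G S₁ → Connected G S₂ →
                x ∈ S₁ → x ∈ S₂ → Connected G (S₁ ∪ S₂)
  ∪-connected {x = x} {S₁} {S₂} conn₁ conn₂ x∈S₁ x∈S₂ u v u∈ v∈ =
    _ , walk-append (proj₂ (to-hub u∈)) (proj₂ (from-hub v∈))
    where
      to-hub : ∀ {u} → u ∈ S₁ ∪ S₂ → ∃[ k ] Walk G (S₁ ∪ S₂) u x k
      to-hub u∈ with x∈p∪q⁻ S₁ S₂ u∈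
      ... | inj₁ u∈S₁ = _ , walk-mono (p⊆p∪q S₂) (proj₂ (conn₁ _ _ u∈S₁ x∈S₁))
      ... | inj₂ u∈S₂ = _ , walk-mono (q⊆p∪q S₁ S₂) (proj₂ (conn₂ _ _ u∈S₂ x∈S₂))
      from-hub : ∀ {v} → v ∈ S₁ ∪ S₂ → ∃[ k ] Walk G (S₁ ∪ S₂) x v k
      from-hub v∈ with x∈p∪q⁻ S₁ S₂ v∈
      ... | inj₁ v∈S₁ = _ , walk-mono (p⊆p∪q S₂) (proj₂ (conn₁ _ _ x∈S₁ v∈S₁))
      ... | inj₂ v∈S₂ = _ , walk-mono (q⊆p∪q S₁ S₂) (proj₂ (conn₂ _ _ x∈S₂ v∈S₂))

  Ecc-unique : ∀ {e e′} → Ecc G S x e → Ecc G S x e′ → e ≡ e′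
  Ecc-unique (bound , v , v∈S , Dv) (bound′ , v′ , v′∈S , Dv′) =
    ≤-antisym (bound′ v _ v∈S Dv) (bound v′ _ v′∈S Dv′)

-- Paths in a graph without cycles.
module Acyclic {n : ℕ} (G : Graph n) (acyclic : ¬ HasCycle G) where
  open Walks G

  private variable
    u v y b : V
    j k m : ℕ

  -- Let p be a path from u to v and q a path from y to v avoiding u, and let
  -- the path r join y to a neighbour b of u, avoiding p and meeting q only
  -- at y.  Then the first vertex of q on p closes a cycle, which is absurd.
  -- (Induction on q: while q avoids p, its vertices are moved onto r.)
  no-detour : {p : GWalk u v k} → IsPath p → {r : GWalk y b j} → IsPath r → b ~ u →
              (∀ {z} → z ∈ʷ r → z ∉ʷ p) →
              {q : GWalk y v m} → IsPath q → (∀ {z} → z ∈ʷ q → z ∈ʷ r → z ≡ y) →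
              u ∉ʷ q → ⊥
  no-detour {p = p} _ _ _ r∩p=∅ {q = []} _ _ _ = r∩p=∅ (first refl) (end∈ʷ p)
  no-detour {p = p} p-path {r = r} r-path b~u r∩p=∅
            {q = _∷_ {w = y′} e q} (y∉q ∷ q-path) q∩r u∉q with y′ ∈ʷ? p
  ... | yes y′∈p =
    acyclic (chord-cycle (C.prefix ++ (~-sym e ∷ r))
                         (++-path C.prefix-path (y′∉r ∷ r-path) meet) length≥2 b~u)
    where
      module C = Split (split p-path y′∈p)
      y′∉r : y′ ∉ʷ r
      y′∉r y′∈r = y∉q (subst (_∈ʷ q) (q∩r (later (first refl)) y′∈r) (first refl))
      meet : ∀ {z} → z ∈ʷ C.prefix → z ∈ʷ ~-sym e ∷ r → z ≡ y′
      meet z∈prefix = [ id , (λ z∈r → ⊥-elim (r∩p=∅ z∈r (C.prefix⊆ z∈prefix))) ]′ ∘ ∈ʷ-∷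
      length≥2 = +-mono-≤ (walk-nonempty C.prefix (u∉q ∘ later ∘ first)) (s≤s z≤n)
  ... | no y′∉p = no-detour p-path (y′∉r ∷ r-path) b~u r′∩p=∅ q-path q∩r′ (u∉q ∘ later)
    where
      y′∉r : y′ ∉ʷ r
      y′∉r y′∈r = y∉q (subst (_∈ʷ q) (q∩r (later (first refl)) y′∈r) (first refl))
      r′∩p=∅ : ∀ {z} → z ∈ʷ ~-sym e ∷ r → z ∉ʷ p
      r′∩p=∅ = [ (λ z≡y′ → subst (_∉ʷ p) (≡.sym z≡y′) y′∉p) , r∩p=∅ ]′ ∘ ∈ʷ-∷
      q∩r′ : ∀ {z} → z ∈ʷ q → z ∈ʷ ~-sym e ∷ r → z ≡ y′
      q∩r′ z∈q = [ id , (λ z∈r → ⊥-elim (y∉q (subst (_∈ʷ q) (q∩r (later z∈q) z∈r) z∈q))) ]′ ∘ ∈ʷ-∷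

  path-length-unique : {p : GWalk u v k} {q : GWalk u v m} → IsPath p → IsPath q → k ≡ m
  path-length-unique {p = []}    {q = []}    _         _         = refl
  path-length-unique {p = []}    {q = e ∷ q} _         (u∉q ∷ _) = ⊥-elim (u∉q (end∈ʷ q))
  path-length-unique {p = e ∷ p} {q = []}    (u∉p ∷ _) _         = ⊥-elim (u∉p (end∈ʷ p))
  path-length-unique {p = _∷_ {w = a} e p} {q = _∷_ {w = b} f q}
                     (u∉p ∷ p-path) (u∉q ∷ q-path) with a ≟ b
  ... | yes refl = cong suc (path-length-unique p-path q-path)
  ... | no a≢b with b ∈ʷ? p
  ...   | yes b∈p = ⊥-elim (acyclic (chord-cycle (e ∷ C.prefix) (u∉p ∘ C.prefix⊆ ∷ C.prefix-path)
                                                 (s≤s (walk-nonempty C.prefix a≢b)) (~-sym f)))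
    where module C = Split (split p-path b∈p)
  ...   | no b∉p = ⊥-elim (no-detour (u∉p ∷ p-path) [] (~-sym f) r∩p=∅ q-path (λ _ → ∈ʷ-[]) u∉q)
    where
      r∩p=∅ : ∀ {z} → z ∈ʷ [] {b} → z ∉ʷ e ∷ p
      r∩p=∅ (first refl) = [ u∉q ∘ first ∘ ≡.sym , b∉p ]′ ∘ ∈ʷ-∷

-- The distance function of a tree and the geometry of its subtrees.
module TreeMetric {n : ℕ} (G : Graph n) (tree : IsTree G) where
  open Walks G
  open Acyclic G (proj₂ (proj₂ tree))


  private variable
    u v w x y z c : V
    a d k : ℕ
    S : Subset n

  -- A chosen path between any two vertices; its length is their distance.
  -- (Abstract, so that distances are never unfolded during type checking.)
  abstract
    tree-path : (u v : V) → PathIn (full G) u v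
    tree-path u v = path-in (proj₁ (proj₂ tree)) ∈⊤ ∈⊤

  dist : V → V → ℕ
  dist u v = PathIn.len (tree-path u v)

  geodesic : (u v : V) → GWalk u v (dist u v)
  geodesic u v = PathIn.walk (tree-path u v)

  geodesic-path : IsPath (geodesic u v)
  geodesic-path {u} {v} = PathIn.is-path (tree-path u v)

  -- Since paths are unique up to length, every path is a geodesic.
  path-length : {p : GWalk u v k} → IsPath p → k ≡ dist u v
  path-length p-path = path-length-unique p-path geodesic-path

  dist-≤ : GWalk u v k → dist u v ≤ k
  dist-≤ p = subst (_≤ _) (path-length is-path) shorter
    where open Shortcut (shortcut p)

  dist-sym : dist u v ≡ dist v u
  dist-sym {u} {v} = ≤-antisym (dist-≤ (reverse (geodesic v u))) (dist-≤ (reverse (geodesic u v)))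

  dist-triangle : dist u v ≤ dist u x + dist x v
  dist-triangle {u} {v} {x} = dist-≤ (geodesic u x ++ geodesic x v)

  dist-adjacent : u ~ v → dist u v ≡ 1
  dist-adjacent e = ≡.sym (path-length {p = e ∷ []} ((λ u∈[] → ~-irrefl e (∈ʷ-[] u∈[])) ∷ []))

  on-geodesic : z ∈ʷ geodesic u v → dist u v ≡ dist u z + dist z v
  on-geodesic z∈ = trans (≡.sym C.lengths) (≡.cong₂ _+_ (path-length C.prefix-path) (path-length C.suffix-path))
    where module C = Split (split geodesic-path z∈)

  neighbour-dist : x ~ y → dist x z ≡ suc (dist y z) ⊎ dist y z ≡ suc (dist x z)
  neighbour-dist {x} {y} {z} e with y ∈ʷ? geodesic x z
  ... | yes y∈ = inj₁ (trans (on-geodesic y∈) (cong (_+ dist y z) (dist-adjacent e)))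
  ... | no  y∉ = inj₂ (≡.sym (path-length {p = ~-sym e ∷ geodesic x z} (y∉ ∷ geodesic-path)))

  across-edge : x ~ y → dist y u ≡ suc (dist x u) → dist x w ≡ suc (dist y w) →
                dist u w ≡ dist u x + suc (dist y w)
  across-edge {x} {y} {u} {w} e u-side w-side =
    ≡.sym (path-length (++-path geodesic-path (apart (end∈ʷ (geodesic u x)) ∷ geodesic-path) meet))
    where
      apart : z ∈ʷ geodesic u x → z ∉ʷ geodesic y w
      apart {z} z∈P z∈Q =
        <⇒≱ (≤-trans (s≤s z-nearer-x) z-nearer-y) (≤-trans (≤-reflexive dist-sym) (n≤1+n _))
        where
          z-nearer-x : suc (dist z x) ≤ dist y z
          z-nearer-x = +-cancelˡ-≤ (dist u z) _ _ (begin
            dist u z + suc (dist z x) ≡⟨ +-suc (dist u z) _ ⟩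
            suc (dist u z + dist z x) ≡⟨ cong suc (≡.sym (on-geodesic z∈P)) ⟩
            suc (dist u x)            ≡⟨ cong suc dist-sym ⟩
            suc (dist x u)            ≡⟨ ≡.sym u-side ⟩
            dist y u                  ≤⟨ dist-triangle ⟩
            dist y z + dist z u       ≡⟨ +-comm (dist y z) _ ⟩
            dist z u + dist y z       ≡⟨ cong (_+ dist y z) dist-sym ⟩
            dist u z + dist y z       ∎)
          z-nearer-y : suc (dist y z) ≤ dist x z
          z-nearer-y = +-cancelʳ-≤ (dist z w) _ _ (begin
            suc (dist y z + dist z w) ≡⟨ cong suc (≡.sym (on-geodesic z∈Q)) ⟩
            suc (dist y w)            ≡⟨ ≡.sym w-side ⟩
            dist x w                  ≤⟨ dist-triangle ⟩
            dist x z + dist z w       ∎)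
      meet : z ∈ʷ geodesic u x → z ∈ʷ e ∷ geodesic y w → z ≡ x
      meet z∈P = [ id , ⊥-elim ∘ apart z∈P ]′ ∘ ∈ʷ-∷

  Dist→dist : Dist G S u v d → d ≡ dist u v
  Dist→dist (route , minimal) =
    ≤-antisym (subst (_ ≤_) (path-length is-path) (minimal _ (lift walk (forget⊆ route ∘ walk⊆))))
              (dist-≤ (forget route))
    where open Shortcut (shortcut (forget route))

  dist→Dist : Connected G S → u ∈ S → v ∈ S → Dist G S u v (dist u v)
  dist→Dist conn u∈S v∈S =
    subst (Walk G _ _ _) (path-length is-path) (lift walk inside) , λ _ → dist-≤ ∘ forget
    where open PathIn (path-in conn u∈S v∈S)

  step-towards : Connected G S → c ∈ S → u ∈ S → dist c u ≡ suc a →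
                 ∃[ c′ ] (c′ ∈ S × c ~ c′ × dist c′ u ≡ a)
  step-towards conn c∈S u∈S c-far = first-step walk is-path inside (trans (path-length is-path) c-far)
    where
      open PathIn (path-in conn c∈S u∈S)
      first-step : (p : GWalk c u k) → IsPath p → (∀ {z} → z ∈ʷ p → z ∈ S) → k ≡ suc a →
                   ∃[ c′ ] (c′ ∈ S × c ~ c′ × dist c′ u ≡ a)
      first-step (e ∷ p) (_ ∷ p-path) p⊆S refl = _ , p⊆S (later (first refl)) , e , ≡.sym (path-length p-path)

  members : Subset n → List V
  members S = filter (_∈? S) (allFin n)

  member : v ∈ S → v ∈ᴸ members S
  member {S = S} v∈S = ∈-filter⁺ (_∈? S) (∈-allFin _) v∈S

  -- (Abstract, so that the maximisation is never unfolded.)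
  abstract
    farthest : Subset n → V → V
    farthest S x = argmax (dist x) x (members S)

    farthest∈ : x ∈ S → farthest S x ∈ S
    farthest∈ {x} {S} x∈S = argmax-all (dist x) x∈S (all-filter (_∈? S) (allFin n))

    dist≤eccentricity : v ∈ S → dist x v ≤ dist x (farthest S x)
    dist≤eccentricity {v} {S} {x} v∈S = All.lookup (f[xs]≤f[argmax] {f = dist x} x (members S)) (member v∈S)

  eccentricity : Subset n → V → ℕ
  eccentricity S x = dist x (farthest S x)

  eccentricity-Ecc : Connected G S → x ∈ S → Ecc G S x (eccentricity S x)
  eccentricity-Ecc conn x∈S =
    (λ v d v∈S Dv → subst (_≤ _) (≡.sym (Dist→dist Dv)) (dist≤eccentricity v∈S)) ,
    _ , farthest∈ x∈S , dist→Dist conn x∈S (farthest∈ x∈S)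

  Central : Subset n → V → Set
  Central S c = c ∈ S × (∀ w → w ∈ S → eccentricity S c ≤ eccentricity S w)

  central⇒InCenter : Connected G S → Central S c → InCenter G S c
  central⇒InCenter conn (c∈S , least) =
    c∈S , _ , eccentricity-Ecc conn c∈S ,
    λ w e w∈S ecc → subst (_ ≤_) (Ecc-unique (eccentricity-Ecc conn w∈S) ecc) (least w w∈S)

  InCenter⇒central : Connected G S → InCenter G S c → Central S c
  InCenter⇒central conn (c∈S , e , ecc , least) =
    c∈S , λ w w∈S → subst (_≤ _) (Ecc-unique ecc (eccentricity-Ecc conn c∈S))
                                  (least w _ w∈S (eccentricity-Ecc conn w∈S))

  central-exists : x ∈ S → ∃ (Central S)
  central-exists {x} {S} x∈S =
    _ , argmin-all (eccentricity S) x∈S (all-filter (_∈? S) (allFin n)) ,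
    λ w w∈S → All.lookup (f[argmin]≤f[xs] {f = eccentricity S} x (members S)) (member w∈S)

  Bounded : Subset n → ℕ → Set
  Bounded S d = ∀ {u v} → u ∈ S → v ∈ S → dist u v ≤ d

  -- Step from c to
  -- the neighbour c′ towards a farthest vertex w; the vertex z farthest from
  -- c′ lies beyond c, so the geodesic from w to z crosses the edge c′c.
  radius-bound : Connected G S → Central S c → Bounded S d →
                 eccentricity S c + eccentricity S c ≤ suc d
  radius-bound {S} {c} {d} conn (c∈S , least) bounded with eccentricity S c in ecc≡
  ... | zero   = z≤n
  ... | suc e′ with step-towards conn c∈S (farthest∈ c∈S) ecc≡
  ...   | c′ , c′∈S , c~c′ , c′w≡e′ = s≤s (begin
      e′ + suc e′                 ≤⟨ +-mono-≤ (≤-reflexive (≡.sym (trans dist-sym c′w≡e′))) far ⟩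
      dist wc c′ + dist c′ zc     ≡⟨ cong (dist wc c′ +_) zc-side ⟩
      dist wc c′ + suc (dist c zc) ≡⟨ ≡.sym (across-edge (~-sym c~c′) wc-side zc-side) ⟩
      dist wc zc                  ≤⟨ bounded (farthest∈ c∈S) (farthest∈ c′∈S) ⟩
      d                           ∎)
    where
      wc = farthest S c
      zc = farthest S c′
      far : suc e′ ≤ dist c′ zc
      far = least c′ c′∈S
      wc-side : dist c wc ≡ suc (dist c′ wc)
      wc-side = trans ecc≡ (cong suc (≡.sym c′w≡e′))
      zc-side : dist c′ zc ≡ suc (dist c zc)
      zc-side with neighbour-dist {z = zc} c~c′
      ... | inj₂ c′-farther = c′-farther
      ... | inj₁ c-farther  = ⊥-elim (<⇒≱ (≤-trans (s≤s far) (≤-reflexive (≡.sym c-farther)))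
                                          (subst (dist c zc ≤_) ecc≡ (dist≤eccentricity (farthest∈ c′∈S))))

  -- If the eccentricity of a central vertex c exceeds half the diameter and
  -- u realises it, the neighbour c′ of c towards u is central too: a vertex
  -- w with dist c′ w > ecc(c) would lie beyond c and too far from u.
  centre-shift : Connected G S → Central S c → Bounded S d → u ∈ S →
                 dist c u ≡ eccentricity S c → d < eccentricity S c + eccentricity S c →
                 ∃[ c′ ] (Central S c′ × suc (dist c′ u) ≡ eccentricity S c)
  centre-shift {S} {c} {d} {u} conn (c∈S , least) bounded u∈S u-far d<2e with eccentricity S c in ecc≡
  ... | zero  = ⊥-elim (n≮0 d<2e)
  ... | suc a with step-towards conn c∈S u∈S u-far
  ...   | c′ , c′∈S , c~c′ , c′u≡a =
    c′ , (c′∈S , λ w w∈S → ≤-trans (near (farthest∈ c′∈S)) (least w w∈S)) ,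
    cong suc c′u≡a
    where
      near : w ∈ S → dist c′ w ≤ suc a
      near {w} w∈S with neighbour-dist {z = w} c~c′
      ... | inj₁ c-farther  = ≤-trans (n≤1+n _) (≤-trans (≤-reflexive (≡.sym c-farther)) cw≤)
        where cw≤ = subst (dist c w ≤_) ecc≡ (dist≤eccentricity w∈S)
      ... | inj₂ c′-farther = subst (_≤ suc a) (≡.sym c′-farther) (s≤s (≤-pred (≤∧≢⇒< cw≤ not-beyond)))
        where
          cw≤ = subst (dist c w ≤_) ecc≡ (dist≤eccentricity w∈S)
          not-beyond : dist c w ≢ suc a
          not-beyond cw≡ = <⇒≱ d<2e (begin
            suc a + suc a              ≡⟨ ≡.sym (+-suc a (suc a)) ⟩
            a + suc (suc a)            ≡⟨ ≡.cong₂ (λ p q → p + suc q) (≡.sym (trans dist-sym c′u≡a)) (≡.sym cw≡) ⟩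
            dist u c′ + suc (dist c w) ≡⟨ ≡.sym (across-edge (~-sym c~c′) (trans u-far (cong suc (≡.sym c′u≡a))) c′-farther) ⟩
            dist u w                   ≤⟨ bounded u∈S w∈S ⟩
            d                          ∎)

  -- If every central vertex of S₁ is central in
  -- S₂, then vertices u ∈ S₁ and v ∈ S₂ are within max(d₁, d₂).  Otherwise
  -- the estimate dist u v ≤ ecc₁(c) + ecc₂(c) through a central c of S₁ is
  -- tight, so the neighbour c′ of c towards u is central in S₁, hence in S₂,
  -- and the route from u through c′ to v is shorter still.
  cross-bound : {S₁ S₂ : Subset n} {d₁ d₂ : ℕ} {c u v : V} →
                Connected G S₁ → Connected G S₂ → (∀ c → Central S₁ c → Central S₂ c) →
                Central S₁ c → Bounded S₁ d₁ → Bounded S₂ d₂ →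
                u ∈ S₁ → v ∈ S₂ → dist u v ≤ d₁ ⊔ d₂
  cross-bound {S₁} {S₂} {d₁} {d₂} {c} {u} {v} conn₁ conn₂ shared c-central bounded₁ bounded₂ u∈S₁ v∈S₂
    with dist u v ≤? d₁ ⊔ d₂
  ... | yes within = within
  ... | no  beyond
    with radii-tight (≰⇒> beyond) via-c (dist≤eccentricity u∈S₁) (dist≤eccentricity v∈S₂)
                     (radius-bound conn₁ c-central bounded₁)
                     (radius-bound conn₂ (shared c c-central) bounded₂)
    where
      via-c : dist u v ≤ dist c u + dist c v
      via-c = ≤-trans dist-triangle (≤-reflexive (cong (_+ dist c v) dist-sym))
  ... | u-far , radii≤ , d₁<2e₁ with centre-shift conn₁ c-central bounded₁ u∈S₁ u-far d₁<2e₁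
  ... | c′ , c′-central , c′-nearer = ⊥-elim (<-irrefl refl (begin-strict
    dist u v                                ≤⟨ dist-triangle ⟩
    dist u c′ + dist c′ v                   ≡⟨ cong (_+ dist c′ v) dist-sym ⟩
    dist c′ u + dist c′ v                   <⟨ +-mono-<-≤ (≤-reflexive c′-nearer) c′v≤ ⟩
    eccentricity S₁ c + eccentricity S₂ c   ≤⟨ radii≤ ⟩
    dist u v                                ∎))
    where
      c′v≤ : dist c′ v ≤ eccentricity S₂ c
      c′v≤ = ≤-trans (dist≤eccentricity v∈S₂) (proj₂ (shared c′ c′-central) c (proj₁ (shared c c-central)))

  ∪-bounded : {S₁ S₂ : Subset n} {d₁ d₂ : ℕ} → Bounded S₁ d₁ → Bounded S₂ d₂ →
              (∀ {u v} → u ∈ S₁ → v ∈ S₂ → dist u v ≤ d₁ ⊔ d₂) →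
              Bounded (S₁ ∪ S₂) (d₁ ⊔ d₂)
  ∪-bounded {S₁} {S₂} {d₁} {d₂} bounded₁ bounded₂ cross u∈ v∈
    with x∈p∪q⁻ S₁ S₂ u∈ | x∈p∪q⁻ S₁ S₂ v∈
  ... | inj₁ u∈S₁ | inj₁ v∈S₁ = ≤-trans (bounded₁ u∈S₁ v∈S₁) (m≤m⊔n d₁ d₂)
  ... | inj₁ u∈S₁ | inj₂ v∈S₂ = cross u∈S₁ v∈S₂
  ... | inj₂ u∈S₂ | inj₁ v∈S₁ = subst (_≤ d₁ ⊔ d₂) dist-sym (cross v∈S₁ u∈S₂)
  ... | inj₂ u∈S₂ | inj₂ v∈S₂ = ≤-trans (bounded₂ u∈S₂ v∈S₂) (m≤n⊔m d₁ d₂)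

  Realised : Subset n → ℕ → Set
  Realised S d = ∃[ u ] ∃[ v ] (u ∈ S × v ∈ S × dist u v ≡ d)

  ∪-realised : {S₁ S₂ : Subset n} {d₁ d₂ : ℕ} → Realised S₁ d₁ → Realised S₂ d₂ →
               Realised (S₁ ∪ S₂) (d₁ ⊔ d₂)
  ∪-realised {S₁} {S₂} {d₁} {d₂} (u , v , u∈ , v∈ , uv≡d₁) (u′ , v′ , u′∈ , v′∈ , u′v′≡d₂)
    with ≤-total d₁ d₂
  ... | inj₁ d₁≤d₂ = u′ , v′ , q⊆p∪q S₁ S₂ u′∈ , q⊆p∪q S₁ S₂ v′∈ , trans u′v′≡d₂ (≡.sym (m≤n⇒m⊔n≡n d₁≤d₂))
  ... | inj₂ d₂≤d₁ = u , v , p⊆p∪q S₂ u∈ , p⊆p∪q S₂ v∈ , trans uv≡d₁ (≡.sym (m≥n⇒m⊔n≡m d₂≤d₁))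

  Diam→bounded : Diam G S d → Bounded S d
  Diam→bounded (conn , bound , _) u∈S v∈S = bound _ _ _ u∈S v∈S (dist→Dist conn u∈S v∈S)

  Diam→realised : Diam G S d → Realised S d
  Diam→realised (_ , _ , u , v , u∈S , v∈S , Duv) = u , v , u∈S , v∈S , ≡.sym (Dist→dist Duv)

  bounded-realised⇒Diam : Connected G S → Bounded S d → Realised S d → Diam G S d
  bounded-realised⇒Diam conn bounded (u , v , u∈S , v∈S , uv≡d) =
    conn ,
    (λ _ _ _ u∈ v∈ D → subst (_≤ _) (≡.sym (Dist→dist D)) (bounded u∈ v∈)) ,
    u , v , u∈S , v∈S , subst (Dist G _ u v) uv≡d (dist→Dist conn u∈S v∈S)


lemma3p3 : ∀ {n : ℕ} (T : Graph n) → IsTree T →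
    ∀ (T₁ T₂ : Subset n) → IsSubtree T T₁ → IsSubtree T T₂ →
    (∀ u → InCenter T T₁ u → InCenter T T₂ u) →
    ∀ (d₁ d₂ : ℕ) → Diam T T₁ d₁ → Diam T T₂ d₂ →
    Diam T (T₁ ∪ T₂) (d₁ ⊔ d₂)
lemma3p3 T tree T₁ T₂ (nonempty₁ , conn₁) (_ , conn₂) centres d₁ d₂ diam₁ diam₂ =
  bounded-realised⇒Diam
    (∪-connected conn₁ conn₂ (proj₁ c-central) (proj₁ (shared _ c-central)))
    (∪-bounded bounded₁ bounded₂ (cross-bound conn₁ conn₂ shared c-central bounded₁ bounded₂))
    (∪-realised (Diam→realised diam₁) (Diam→realised diam₂))
  where
    open Walks T using (∪-connected)
    open TreeMetric T tree
    shared : ∀ c → Central T₁ c → Central T₂ c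
    shared c = InCenter⇒central conn₂ ∘ centres c ∘ central⇒InCenter conn₁
    c-central : Central T₁ (proj₁ (central-exists (proj₂ nonempty₁)))
    c-central = proj₂ (central-exists (proj₂ nonempty₁))
    bounded₁ : Bounded T₁ d₁
    bounded₁ = Diam→bounded diam₁
    bounded₂ : Bounded T₂ d₂
    bounded₂ = Diam→bounded diam₂
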